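{- Let $p$ be an odd prime and let $\{A_n\}_{n\ge0}$ be a sequence of rational numbers with $A_0,A_1,\ldots,A_{(p-1)/2}$ rational $p$-integers. If $\{A_n\}$ is an even sequence and $p\equiv3\pmod4$, or if $\{A_n\}$ is an odd sequence and $p\equiv1\pmod4$, then $$\sum_{k=0}^{(p-1)/2}\frac{\binom{2k}{k}}{2^k}A_k\equiv0\pmod p.$$
   Context: A sequence $\{a_n\}_{n\ge0}$ is called an even sequence if $\sum_{k=0}^n\binom nk(-1)^ka_k=a_n$ for all $n=0,1,2,\ldots$, and an odd sequence if $\sum_{k=0}^n\binom nk(-1)^ka_k=-a_n$ for all $n=0,1,2,\ldots$. A rational $p$-integer is a rational number whose denominator (in lowest terms) is coprime to $p$; $\mathbb Z_p$ denotes the ring of such numbers, and for $x,y\in\mathbb Z_p$, $x\equiv y\pmod p$ means $(x-y)/p\in\mathbb Z_p$. -}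

module Defs where

open import Data.Nat as ℕ using (ℕ; zero; suc; _∸_)
open import Data.Nat.Properties using (m^n≢0)
open import Data.Nat.Coprimality using (Coprime)
open import Data.Nat.Combinatorics using (_C_)
open import Data.Integer as ℤ using (ℤ; +_)
open import Data.Rational as ℚ using (ℚ; ↧ₙ_; _+_; _*_; _-_; -_; _/_; 0ℚ)
open import Data.Product using (∃; _×_)
open import Relation.Binary.PropositionalEquality using (_≡_)

sign : ℕ → ℚ
sign zero = ℚ.1ℚ
sign (suc k) = - sign k

ι : ℕ → ℚ
ι n = (+ n) / 1

sumTo : ℕ → (ℕ → ℚ) → ℚ
sumTo zero f = f 0
sumTo (suc n) f = sumTo n f + f (suc n)

binTrans : (ℕ → ℚ) → ℕ → ℚ
binTrans a n = sumTo n (λ k → ι (n C k) * (sign k * a k))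

EvenSeq : (ℕ → ℚ) → Set
EvenSeq a = ∀ n → binTrans a n ≡ a n

OddSeq : (ℕ → ℚ) → Set
OddSeq a = ∀ n → binTrans a n ≡ - a n

-- rational p-integer: denominator (in lowest terms; ℚ is always normalised) coprime to p
IsPInt : ℕ → ℚ → Set
IsPInt p x = Coprime (↧ₙ x) p

-- x ≡ y (mod p) : (x - y)/p is a p-integer, i.e. x - y = p * z for a p-integer z
CongMod : ℕ → ℚ → ℚ → Set
CongMod p x y = ∃ λ z → IsPInt p z × (x - y ≡ ι p * z)

cb : ℕ → ℚ
cb k = (+ ((2 ℕ.* k) C k)) / (2 ℕ.^ k)
  where instance _ = m^n≢0 2 k

module Submission where

-- Theorem 4.4.  Put m = (p-1)/2, so that p = 2m+1, and T = Σ_{k≤m} C(m,k) (-2)^k A_k.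
--
-- Let E be the shift (E f)(n) = f(n+1).  For geometric weights
--    w_k = c^k the binomial sum Σ_k C(m,k) w_k f_k is ((1+cE)^m f)(0); in particular the
--    binomial transform of A at j is ((1-E)^j A)(0).  As 1 - 2(1-E) = -(1-2E), the
--    reflection identity  Σ_k C(m,k)(-2)^k ((1-E)^k f)(n) = (-1)^m ((1-2E)^m f)(n)  holds.
--    Hence T = (-1)^m T for an even sequence and T = -(-1)^m T for an odd one; under the
--    hypotheses on p mod 4 this reads T = -T, so T = 0.
-- 2. Congruence of coefficients.  u_k = C(2k,k)/2^k and v_k = C(m,k)(-2)^k satisfy
--    (k+1) u_{k+1} = (2k+1) u_k  and  (k+1) v_{k+1} = (2k+1-p) v_k.  Recurrences that agree
--    modulo p give u_k = v_k + p z_k with an explicit z_k, a p-integer while k < p because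
--    only the denominators 1, ..., k occur.

open import Defs
open import Data.Nat as ℕ using (ℕ; zero; suc; _∸_; _≤_; _<_; _%_; _/_; z≤n; s≤s)
import Data.Nat.Properties as ℕₚ
open import Data.Nat.DivMod using (m≡m%n+[m/n]*n; m*n/n≡m)
open import Data.Nat.Divisibility using (_∣_; divides; ∣-trans)
open import Data.Nat.Coprimality using (Coprime; 1-coprimeTo; prime⇒coprime)
import Data.Nat.Coprimality as Coprimality
open import Data.Nat.Primality using (Prime; prime⇒irreducible; euclidsLemma)
open import Data.Nat.Combinatorics
  using (_C_; nCk+nC[k+1]≡[n+1]C[k+1]; k>n⇒nCk≡0; nC1≡n; nCk≡nC[n∸k])
open import Data.Nat.Tactic.RingSolver using (solve-∀)
open import Data.Integer as ℤ using (ℤ; +_)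
import Data.Integer.Properties as ℤₚ
open import Data.Rational as ℚ using (ℚ; mkℚ; _+_; _*_; _-_; -_; 0ℚ; 1ℚ; ½; ↧_; ↧ₙ_; toℚᵘ)
import Data.Rational.Properties as ℚₚ
open import Data.Rational.Unnormalised as ℚᵘ using (mkℚᵘ; *≡*)
import Data.Rational.Unnormalised.Properties as ℚᵘₚ
open import Data.Rational.Solver using (module +-*-Solver)
open +-*-Solver using (solve; _:=_; _:+_; _:*_; _:-_; :-_; con)
open import Data.Sum using (_⊎_; inj₁; inj₂)
open import Data.Product using (_×_; _,_)
open import Relation.Binary.PropositionalEquality
open ≡-Reasoning

negOne negTwo : ℚ
negOne = - 1ℚ
negTwo = - (1ℚ + 1ℚ)

negTwoPow : ℕ → ℚ
negTwoPow zero = 1ℚ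
negTwoPow (suc k) = negTwo * negTwoPow k

ι-canonical : ∀ n → ι n ≡ mkℚ (+ n) 0 (Coprimality.sym (1-coprimeTo n))
ι-canonical n = ℚₚ.normalize-coprime (Coprimality.sym (1-coprimeTo n))

ι-+ : ∀ a b → ι (a ℕ.+ b) ≡ ι a + ι b
ι-+ a b = begin
  ι (a ℕ.+ b)                            ≡⟨ cong (ℚ._/ 1) (ℤₚ.pos-+ a b) ⟩
  (+ a ℤ.+ + b) ℚ./ 1                    ≡⟨ cong₂ (λ i j → (i ℤ.+ j) ℚ./ 1)
                                                  (ℤₚ.*-identityʳ (+ a)) (ℤₚ.*-identityʳ (+ b)) ⟨
  (+ a ℤ.* + 1 ℤ.+ + b ℤ.* + 1) ℚ./ 1    ≡⟨ cong₂ _+_ (ι-canonical a) (ι-canonical b) ⟨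
  ι a + ι b                              ∎

ι-* : ∀ a b → ι (a ℕ.* b) ≡ ι a * ι b
ι-* a b = begin
  ι (a ℕ.* b)            ≡⟨ cong (ℚ._/ 1) (ℤₚ.pos-* a b) ⟩
  (+ a ℤ.* + b) ℚ./ 1    ≡⟨ cong₂ _*_ (ι-canonical a) (ι-canonical b) ⟨
  ι a * ι b              ∎

ι-odd : ∀ k → ι (suc (k ℕ.+ k)) ≡ 1ℚ + (ι k + ι k)
ι-odd k = trans (ι-+ 1 (k ℕ.+ k)) (cong (λ x → 1ℚ + x) (ι-+ k k))

toℚᵘ-/ : ∀ i n .{{_ : ℕ.NonZero n}} → toℚᵘ (i ℚ./ n) ℚᵘ.≃ mkℚᵘ i (ℕ.pred n)
toℚᵘ-/ i n =
  ℚᵘₚ.≃-trans (ℚₚ.toℚᵘ-cong (ℚₚ./-cong {i} {n} refl (sym (ℕₚ.suc-pred n))))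
              (ℚₚ.toℚᵘ-fromℚᵘ (mkℚᵘ i (ℕ.pred n)))

scaled-fractions-≡ : ∀ a b c d n n' .{{_ : ℕ.NonZero n}} .{{_ : ℕ.NonZero n'}} →
                     a ℕ.* b ℕ.* n' ≡ c ℕ.* d ℕ.* n →
                     (+ a ℚ./ n) * ι b ≡ (+ c ℚ./ n') * ι d
scaled-fractions-≡ a b c d n n' h = ℚₚ.toℚᵘ-injective
  (ℚᵘₚ.≃-trans (unreduced a b n) (ℚᵘₚ.≃-trans (*≡* cross) (ℚᵘₚ.≃-sym (unreduced c d n'))))
  where
  unreduced : ∀ a b m .{{_ : ℕ.NonZero m}} →
              toℚᵘ ((+ a ℚ./ m) * ι b) ℚᵘ.≃ mkℚᵘ (+ a) (ℕ.pred m) ℚᵘ.* mkℚᵘ (+ b) 0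
  unreduced a b m = ℚᵘₚ.≃-trans (ℚₚ.toℚᵘ-homo-* (+ a ℚ./ m) (ι b))
                                (ℚᵘₚ.*-cong (toℚᵘ-/ (+ a) m) (toℚᵘ-/ (+ b) 1))
  denominator : ∀ m .{{_ : ℕ.NonZero m}} → suc (ℕ.pred m ℕ.* 1) ≡ m
  denominator m = trans (cong suc (ℕₚ.*-identityʳ (ℕ.pred m))) (ℕₚ.suc-pred m)
  cross : (+ a ℤ.* + b) ℤ.* + suc (ℕ.pred n' ℕ.* 1) ≡ (+ c ℤ.* + d) ℤ.* + suc (ℕ.pred n ℕ.* 1)
  cross = begin
    (+ a ℤ.* + b) ℤ.* + suc (ℕ.pred n' ℕ.* 1)
                                                ≡⟨ cong₂ (λ x y → x ℤ.* + y) (ℤₚ.pos-* a b) (sym (denominator n')) ⟨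
    + (a ℕ.* b) ℤ.* + n'                        ≡⟨ ℤₚ.pos-* (a ℕ.* b) n' ⟨
    + (a ℕ.* b ℕ.* n')                          ≡⟨ cong +_ h ⟩
    + (c ℕ.* d ℕ.* n)                           ≡⟨ ℤₚ.pos-* (c ℕ.* d) n ⟩
    + (c ℕ.* d) ℤ.* + n
                                                ≡⟨ cong₂ (λ x y → x ℤ.* + y) (ℤₚ.pos-* c d) (sym (denominator n)) ⟩
    (+ c ℤ.* + d) ℤ.* + suc (ℕ.pred n ℕ.* 1)   ∎

inverseSuc : ℕ → ℚ
inverseSuc k = + 1 ℚ./ suc k

inverseSuc-inverse : ∀ k → inverseSuc k * ι (suc k) ≡ 1ℚ
inverseSuc-inverse k = scaled-fractions-≡ 1 (suc k) 1 1 (suc k) 1 (ℕₚ.*-identityʳ (1 ℕ.* suc k))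

divide-by-suc : ∀ {x y} k → x * ι (suc k) ≡ y → x ≡ y * inverseSuc k
divide-by-suc {x} {y} k h = begin
  x                              ≡⟨ ℚₚ.*-identityʳ x ⟨
  x * 1ℚ                         ≡⟨ cong (x *_) (inverseSuc-inverse k) ⟨
  x * (inverseSuc k * ι (suc k)) ≡⟨ solve 3 (λ x r s → x :* (r :* s) := (x :* s) :* r)
                                          refl x (inverseSuc k) (ι (suc k)) ⟩
  (x * ι (suc k)) * inverseSuc k ≡⟨ cong (_* inverseSuc k) h ⟩
  y * inverseSuc k               ∎

sumTo-cong : ∀ n {f g : ℕ → ℚ} → (∀ k → f k ≡ g k) → sumTo n f ≡ sumTo n g
sumTo-cong zero    f≡g = f≡g 0
sumTo-cong (suc n) f≡g = cong₂ _+_ (sumTo-cong n f≡g) (f≡g (suc n))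

sumTo-shift : ∀ n (f : ℕ → ℚ) → sumTo (suc n) f ≡ f 0 + sumTo n (λ k → f (suc k))
sumTo-shift zero    f = refl
sumTo-shift (suc n) f = begin
  sumTo (suc n) f + f (suc (suc n))                     ≡⟨ cong (_+ f (suc (suc n))) (sumTo-shift n f) ⟩
  (f 0 + sumTo n (λ k → f (suc k))) + f (suc (suc n))   ≡⟨ ℚₚ.+-assoc (f 0) _ _ ⟩
  f 0 + sumTo (suc n) (λ k → f (suc k))                 ∎

sumTo-+ : ∀ n (f g : ℕ → ℚ) → sumTo n (λ k → f k + g k) ≡ sumTo n f + sumTo n g
sumTo-+ zero    f g = refl
sumTo-+ (suc n) f g = begin
  sumTo n (λ k → f k + g k) + (f (suc n) + g (suc n))   ≡⟨ cong (_+ (f (suc n) + g (suc n))) (sumTo-+ n f g) ⟩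
  (sumTo n f + sumTo n g) + (f (suc n) + g (suc n))     ≡⟨ solve 4 (λ a b c d → (a :+ b) :+ (c :+ d) := (a :+ c) :+ (b :+ d))
                                                             refl (sumTo n f) (sumTo n g) (f (suc n)) (g (suc n)) ⟩
  sumTo (suc n) f + sumTo (suc n) g                     ∎

sumTo-scale : ∀ n c (f : ℕ → ℚ) → sumTo n (λ k → c * f k) ≡ c * sumTo n f
sumTo-scale zero    c f = refl
sumTo-scale (suc n) c f = trans (cong (_+ c * f (suc n)) (sumTo-scale n c f)) (sym (ℚₚ.*-distribˡ-+ c _ _))

coprime-∣ : ∀ {d n p} → d ∣ n → Coprime n p → Coprime d p
coprime-∣ d∣n coprime (i∣d , i∣p) = coprime (∣-trans i∣d d∣n , i∣p)

∣-of-ℤ-identity : ∀ {a g b : ℤ} → a ℤ.* g ≡ b → ℤ.∣ a ∣ ∣ ℤ.∣ b ∣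
∣-of-ℤ-identity {a} {g} refl = divides ℤ.∣ g ∣ (trans (ℤₚ.abs-* a g) (ℕₚ.*-comm _ ℤ.∣ g ∣))

↧ₙ-+ : ∀ x y → ↧ₙ (x + y) ∣ ↧ₙ x ℕ.* ↧ₙ y
↧ₙ-+ x y = subst (↧ₙ (x + y) ∣_) (ℤₚ.abs-* (↧ x) (↧ y)) (∣-of-ℤ-identity {↧ (x + y)} (ℚₚ.↧-+ x y))

↧ₙ-* : ∀ x y → ↧ₙ (x * y) ∣ ↧ₙ x ℕ.* ↧ₙ y
↧ₙ-* x y = subst (↧ₙ (x * y) ∣_) (ℤₚ.abs-* (↧ x) (↧ y)) (∣-of-ℤ-identity {↧ (x * y)} (ℚₚ.↧-* x y))

↧ₙ-/ : ∀ i n .{{_ : ℕ.NonZero n}} → ↧ₙ (i ℚ./ n) ∣ n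
↧ₙ-/ i n = ∣-of-ℤ-identity {↧ (i ℚ./ n)} (ℚₚ.↧-/ i n)

-- IsPInt p x only mentions the denominator of x.  The record PInt p x is the same property
-- indexed by x itself, which lets the closure lemmas below infer x.
record PInt (p : ℕ) (x : ℚ) : Set where
  constructor pint
  field isPInt : IsPInt p x

open PInt using (isPInt)

module _ {p : ℕ} (p-prime : Prime p) where

  coprime-* : ∀ {a b} → Coprime a p → Coprime b p → Coprime (a ℕ.* b) p
  coprime-* {a} {b} coprime-a coprime-b {i} (i∣ab , i∣p) with prime⇒irreducible p-prime i∣p
  ... | inj₁ i≡1 = i≡1
  ... | inj₂ i≡p with euclidsLemma a b p-prime (subst (_∣ a ℕ.* b) i≡p i∣ab)
  ...   | inj₁ p∣a = coprime-a (subst (_∣ a) (sym i≡p) p∣a , i∣p)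
  ...   | inj₂ p∣b = coprime-b (subst (_∣ b) (sym i≡p) p∣b , i∣p)

  pint-+ : ∀ {x y} → PInt p x → PInt p y → PInt p (x + y)
  pint-+ {x} {y} (pint px) (pint py) = pint (coprime-∣ (↧ₙ-+ x y) (coprime-* px py))

  pint-* : ∀ {x y} → PInt p x → PInt p y → PInt p (x * y)
  pint-* {x} {y} (pint px) (pint py) = pint (coprime-∣ (↧ₙ-* x y) (coprime-* px py))

  pint-/ : ∀ i n .{{_ : ℕ.NonZero n}} → Coprime n p → PInt p (i ℚ./ n)
  pint-/ i n coprime-n = pint (coprime-∣ (↧ₙ-/ i n) coprime-n)

  pint-integer : ∀ i → PInt p (i ℚ./ 1)
  pint-integer i = pint-/ i 1 (1-coprimeTo p)

  pint-ι : ∀ n → PInt p (ι n)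
  pint-ι n = pint-integer (+ n)

  pint-sum : ∀ n (f : ℕ → ℚ) → (∀ k → k ≤ n → PInt p (f k)) → PInt p (sumTo n f)
  pint-sum zero    f pf = pf 0 z≤n
  pint-sum (suc n) f pf =
    pint-+ (pint-sum n f (λ k k≤n → pf k (ℕₚ.m≤n⇒m≤1+n k≤n))) (pf (suc n) ℕₚ.≤-refl)

  pint-inverseSuc : ∀ k → suc k < p → PInt p (inverseSuc k)
  pint-inverseSuc k k<p = pint-/ (+ 1) (suc k) (Coprimality.sym (prime⇒coprime p-prime k<p))

  pint-negTwoPow : ∀ k → PInt p (negTwoPow k)
  pint-negTwoPow zero    = pint-integer (+ 1)
  pint-negTwoPow (suc k) = pint-* (pint-integer ℤ.-[1+ 1 ]) (pint-negTwoPow k)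

-- Absorption identity (k+1)·C(m,k+1) = (m-k)·C(m,k), written without subtraction.
absorption : ∀ m k → (m C suc k) ℕ.* suc k ℕ.+ k ℕ.* (m C k) ≡ m ℕ.* (m C k)
absorption zero zero = refl
absorption zero (suc k)
  rewrite k>n⇒nCk≡0 {0} {suc k} (s≤s z≤n) | k>n⇒nCk≡0 {0} {suc (suc k)} (s≤s z≤n) = ℕₚ.*-zeroʳ (suc k)
absorption (suc m) zero = begin
  (suc m C 1) ℕ.* 1 ℕ.+ 0  ≡⟨ ℕₚ.+-identityʳ _ ⟩
  (suc m C 1) ℕ.* 1        ≡⟨ ℕₚ.*-identityʳ _ ⟩
  suc m C 1                ≡⟨ nC1≡n (suc m) ⟩
  suc m                    ≡⟨ ℕₚ.*-identityʳ (suc m) ⟨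
  suc m ℕ.* 1              ∎
absorption (suc m) (suc j) = begin
  (suc m C suc (suc j)) ℕ.* suc (suc j) ℕ.+ suc j ℕ.* (suc m C suc j)
    ≡⟨ cong₂ (λ x y → x ℕ.* suc (suc j) ℕ.+ suc j ℕ.* y)
             (nCk+nC[k+1]≡[n+1]C[k+1] m (suc j)) (nCk+nC[k+1]≡[n+1]C[k+1] m j) ⟨
  (b ℕ.+ c) ℕ.* suc (suc j) ℕ.+ suc j ℕ.* (a ℕ.+ b)
    ≡⟨ regroup a b c j ⟩
  b ℕ.+ (b ℕ.* suc j ℕ.+ j ℕ.* a) ℕ.+ a ℕ.+ (c ℕ.* suc (suc j) ℕ.+ suc j ℕ.* b)
    ≡⟨ cong₂ (λ x y → b ℕ.+ x ℕ.+ a ℕ.+ y) (absorption m j) (absorption m (suc j)) ⟩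
  b ℕ.+ m ℕ.* a ℕ.+ a ℕ.+ m ℕ.* b
    ≡⟨ collect a b m ⟩
  suc m ℕ.* (a ℕ.+ b)
    ≡⟨ cong (suc m ℕ.*_) (nCk+nC[k+1]≡[n+1]C[k+1] m j) ⟩
  suc m ℕ.* (suc m C suc j) ∎
  where
  a = m C j
  b = m C suc j
  c = m C suc (suc j)
  regroup : ∀ a b c j → (b ℕ.+ c) ℕ.* suc (suc j) ℕ.+ suc j ℕ.* (a ℕ.+ b)
                      ≡ b ℕ.+ (b ℕ.* suc j ℕ.+ j ℕ.* a) ℕ.+ a ℕ.+ (c ℕ.* suc (suc j) ℕ.+ suc j ℕ.* b)
  regroup = solve-∀
  collect : ∀ a b m → b ℕ.+ m ℕ.* a ℕ.+ a ℕ.+ m ℕ.* b ≡ suc m ℕ.* (a ℕ.+ b)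
  collect = solve-∀

central-binomial : ∀ k → ((2 ℕ.* suc k) C suc k) ℕ.* suc k ≡ 2 ℕ.* (suc (k ℕ.+ k) ℕ.* ((2 ℕ.* k) C k))
central-binomial k = begin
  ((2 ℕ.* suc k) C suc k) ℕ.* suc k       ≡⟨ cong (λ n → (n C suc k) ℕ.* suc k) 2k+2≡ ⟩
  (suc (suc (k ℕ.+ k)) C suc k) ℕ.* suc k ≡⟨ cong (ℕ._* suc k) (nCk+nC[k+1]≡[n+1]C[k+1] (suc (k ℕ.+ k)) k) ⟨
  (t ℕ.+ s) ℕ.* suc k                     ≡⟨ cong (λ x → (x ℕ.+ s) ℕ.* suc k) t≡s ⟩
  (s ℕ.+ s) ℕ.* suc k                     ≡⟨ doubling s k ⟩
  2 ℕ.* (s ℕ.* suc k)                     ≡⟨ cong (2 ℕ.*_) s-absorbed ⟩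
  2 ℕ.* (suc (k ℕ.+ k) ℕ.* a)             ≡⟨ cong (λ n → 2 ℕ.* (suc (k ℕ.+ k) ℕ.* (n C k))) (twice k) ⟨
  2 ℕ.* (suc (k ℕ.+ k) ℕ.* ((2 ℕ.* k) C k)) ∎
  where
  a = (k ℕ.+ k) C k
  s = suc (k ℕ.+ k) C suc k
  t = suc (k ℕ.+ k) C k
  twice : ∀ n → 2 ℕ.* n ≡ n ℕ.+ n
  twice n = cong (n ℕ.+_) (ℕₚ.+-identityʳ n)
  2k+2≡ : 2 ℕ.* suc k ≡ suc (suc (k ℕ.+ k))
  2k+2≡ = trans (twice (suc k)) (ℕₚ.+-suc (suc k) k)
  doubling : ∀ s k → (s ℕ.+ s) ℕ.* suc k ≡ 2 ℕ.* (s ℕ.* suc k)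
  doubling = solve-∀
  t≡s : t ≡ s
  t≡s = trans (nCk≡nC[n∸k] (ℕₚ.m≤n⇒m≤1+n (ℕₚ.m≤m+n k k)))
              (cong (suc (k ℕ.+ k) C_) (ℕₚ.m+n∸n≡m (suc k) k))
  s-absorbed : s ℕ.* suc k ≡ suc (k ℕ.+ k) ℕ.* a
  s-absorbed = ℕₚ.+-cancelʳ-≡ (k ℕ.* a) _ _ (begin
    s ℕ.* suc k ℕ.+ k ℕ.* a
      ≡⟨ cong (λ x → x ℕ.* suc k ℕ.+ k ℕ.* a) (nCk+nC[k+1]≡[n+1]C[k+1] (k ℕ.+ k) k) ⟨
    (a ℕ.+ b) ℕ.* suc k ℕ.+ k ℕ.* a        ≡⟨ split a b k ⟩
    a ℕ.* suc k ℕ.+ (b ℕ.* suc k ℕ.+ k ℕ.* a) ≡⟨ cong (a ℕ.* suc k ℕ.+_) (absorption (k ℕ.+ k) k) ⟩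
    a ℕ.* suc k ℕ.+ (k ℕ.+ k) ℕ.* a        ≡⟨ merge a k ⟩
    suc (k ℕ.+ k) ℕ.* a ℕ.+ k ℕ.* a        ∎)
    where
    b = (k ℕ.+ k) C suc k
    split : ∀ a b k → (a ℕ.+ b) ℕ.* suc k ℕ.+ k ℕ.* a ≡ a ℕ.* suc k ℕ.+ (b ℕ.* suc k ℕ.+ k ℕ.* a)
    split = solve-∀
    merge : ∀ a k → a ℕ.* suc k ℕ.+ (k ℕ.+ k) ℕ.* a ≡ suc (k ℕ.+ k) ℕ.* a ℕ.+ k ℕ.* a
    merge = solve-∀

-- opPow c m f n = ((1 + c·E)^m f)(n), where E is the shift (E f)(n) = f(n+1).
opPow : ℚ → ℕ → (ℕ → ℚ) → ℕ → ℚ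
opPow c zero    f n = f n
opPow c (suc m) f n = opPow c m f n + c * opPow c m f (suc n)

opPow-shift : ∀ c m f n → opPow c m (λ k → f (suc k)) n ≡ opPow c m f (suc n)
opPow-shift c zero    f n = refl
opPow-shift c (suc m) f n = cong₂ (λ x y → x + c * y) (opPow-shift c m f n) (opPow-shift c m f (suc n))

opPow-cong : ∀ c m {f g} → (∀ k → f k ≡ g k) → ∀ n → opPow c m f n ≡ opPow c m g n
opPow-cong c zero    f≡g n = f≡g n
opPow-cong c (suc m) f≡g n = cong₂ (λ x y → x + c * y) (opPow-cong c m f≡g n) (opPow-cong c m f≡g (suc n))

opPow-linear : ∀ c m f g d n → opPow c m (λ k → f k + d * g k) n ≡ opPow c m f n + d * opPow c m g n
opPow-linear c zero    f g d n = refl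
opPow-linear c (suc m) f g d n = begin
  opPow c m h n + c * opPow c m h (suc n)
    ≡⟨ cong₂ (λ x y → x + c * y) (opPow-linear c m f g d n) (opPow-linear c m f g d (suc n)) ⟩
  (F n + d * G n) + c * (F (suc n) + d * G (suc n))
    ≡⟨ solve 6 (λ c d a b a' b' → (a :+ d :* b) :+ c :* (a' :+ d :* b') := (a :+ c :* a') :+ d :* (b :+ c :* b'))
             refl c d (F n) (G n) (F (suc n)) (G (suc n)) ⟩
  opPow c (suc m) f n + d * opPow c (suc m) g n ∎
  where
  h F G : ℕ → ℚ
  h k = f k + d * g k
  F = opPow c m f
  G = opPow c m g

opPow-scale : ∀ c m d f n → opPow c m (λ k → d * f k) n ≡ d * opPow c m f n
opPow-scale c zero    d f n = refl
opPow-scale c (suc m) d f n = begin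
  opPow c m (λ k → d * f k) n + c * opPow c m (λ k → d * f k) (suc n)
    ≡⟨ cong₂ (λ x y → x + c * y) (opPow-scale c m d f n) (opPow-scale c m d f (suc n)) ⟩
  d * opPow c m f n + c * (d * opPow c m f (suc n))
    ≡⟨ solve 4 (λ c d a b → d :* a :+ c :* (d :* b) := d :* (a :+ c :* b))
               refl c d (opPow c m f n) (opPow c m f (suc n)) ⟩
  d * opPow c (suc m) f n ∎

opPow-inner : ∀ c m f n → opPow c (suc m) f n ≡ opPow c m (λ k → f k + c * f (suc k)) n
opPow-inner c zero    f n = refl
opPow-inner c (suc m) f n = cong₂ (λ x y → x + c * y) (opPow-inner c m f n) (opPow-inner c m f (suc n))

binomialSum : (ℕ → ℚ) → ℕ → (ℕ → ℚ) → ℚ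
binomialSum w m f = sumTo m (λ k → ι (m C k) * (w k * f k))

sumTo-Pascal : ∀ m (g : ℕ → ℚ) →
  sumTo (suc m) (λ k → ι (suc m C k) * g k)
    ≡ sumTo m (λ k → ι (m C k) * g k) + sumTo m (λ k → ι (m C k) * g (suc k))
sumTo-Pascal m g = begin
  sumTo (suc m) (λ k → ι (suc m C k) * g k)
    ≡⟨ sumTo-shift m _ ⟩
  h 0 + sumTo m (λ k → ι (suc m C suc k) * g (suc k))
    ≡⟨ cong (λ x → h 0 + x) (sumTo-cong m pascal) ⟩
  h 0 + sumTo m (λ k → h (suc k) + h′ k)
    ≡⟨ cong (λ x → h 0 + x) (sumTo-+ m _ _) ⟩
  h 0 + (sumTo m (λ k → h (suc k)) + sumTo m h′)
    ≡⟨ ℚₚ.+-assoc (h 0) _ _ ⟨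
  (h 0 + sumTo m (λ k → h (suc k))) + sumTo m h′
    ≡⟨ cong (_+ sumTo m h′) (sumTo-shift m h) ⟨
  (sumTo m h + h (suc m)) + sumTo m h′
    ≡⟨ cong (λ x → (sumTo m h + x) + sumTo m h′) last-vanishes ⟩
  (sumTo m h + 0ℚ) + sumTo m h′
    ≡⟨ cong (_+ sumTo m h′) (ℚₚ.+-identityʳ (sumTo m h)) ⟩
  sumTo m h + sumTo m h′ ∎
  where
  h h′ : ℕ → ℚ
  h k = ι (m C k) * g k
  h′ k = ι (m C k) * g (suc k)
  pascal : ∀ k → ι (suc m C suc k) * g (suc k) ≡ h (suc k) + h′ k
  pascal k = begin
    ι (suc m C suc k) * g (suc k)                     ≡⟨ cong (λ n → ι n * g (suc k)) (nCk+nC[k+1]≡[n+1]C[k+1] m k) ⟨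
    ι ((m C k) ℕ.+ (m C suc k)) * g (suc k)           ≡⟨ cong (_* g (suc k)) (ι-+ (m C k) (m C suc k)) ⟩
    (ι (m C k) + ι (m C suc k)) * g (suc k)           ≡⟨ ℚₚ.*-distribʳ-+ (g (suc k)) (ι (m C k)) _ ⟩
    h′ k + h (suc k)                                  ≡⟨ ℚₚ.+-comm (h′ k) _ ⟩
    h (suc k) + h′ k                                  ∎
  last-vanishes : h (suc m) ≡ 0ℚ
  last-vanishes = trans (cong (λ n → ι n * g (suc m)) (k>n⇒nCk≡0 (ℕₚ.n<1+n m))) (ℚₚ.*-zeroˡ (g (suc m)))

binomial-expansion : ∀ c (w : ℕ → ℚ) → w 0 ≡ 1ℚ → (∀ k → w (suc k) ≡ c * w k) →
                     ∀ m f → binomialSum w m f ≡ opPow c m f 0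
binomial-expansion c w w₀ w-step zero f = begin
  1ℚ * (w 0 * f 0)    ≡⟨ ℚₚ.*-identityˡ _ ⟩
  w 0 * f 0           ≡⟨ cong (_* f 0) w₀ ⟩
  1ℚ * f 0            ≡⟨ ℚₚ.*-identityˡ _ ⟩
  f 0                 ∎
binomial-expansion c w w₀ w-step (suc m) f = begin
  binomialSum w (suc m) f
    ≡⟨ sumTo-Pascal m (λ k → w k * f k) ⟩
  binomialSum w m f + sumTo m (λ k → ι (m C k) * (w (suc k) * f (suc k)))
    ≡⟨ cong (λ x → binomialSum w m f + x) (sumTo-cong m pull-out) ⟩
  binomialSum w m f + sumTo m (λ k → c * (ι (m C k) * (w k * f (suc k))))
    ≡⟨ cong (λ x → binomialSum w m f + x) (sumTo-scale m c _) ⟩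
  binomialSum w m f + c * binomialSum w m (λ k → f (suc k))
    ≡⟨ cong₂ (λ x y → x + c * y) (binomial-expansion c w w₀ w-step m f)
                                 (binomial-expansion c w w₀ w-step m (λ k → f (suc k))) ⟩
  opPow c m f 0 + c * opPow c m (λ k → f (suc k)) 0
    ≡⟨ cong (λ x → opPow c m f 0 + c * x) (opPow-shift c m f 0) ⟩
  opPow c (suc m) f 0 ∎
  where
  pull-out : ∀ k → ι (m C k) * (w (suc k) * f (suc k)) ≡ c * (ι (m C k) * (w k * f (suc k)))
  pull-out k = trans (cong (λ x → ι (m C k) * (x * f (suc k))) (w-step k))
                     (solve 4 (λ b c w f → b :* ((c :* w) :* f) := c :* (b :* (w :* f)))
                            refl (ι (m C k)) c (w k) (f (suc k)))

negOne-* : ∀ x → negOne * x ≡ - x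
negOne-* x = trans (sym (ℚₚ.neg-distribˡ-* 1ℚ x)) (cong -_ (ℚₚ.*-identityˡ x))

binTrans-opPow : ∀ A j → binTrans A j ≡ opPow negOne j A 0
binTrans-opPow A j = binomial-expansion negOne sign refl (λ k → sym (negOne-* (sign k))) j A

-- Reflection: Σ_k C(m,k)(-2)^k ((1-E)^k f)(n) = (-1)^m ((1-2E)^m f)(n),
-- i.e. (1 - 2(1-E))^m = (-1)^m (1-2E)^m.
reflection : ∀ m f n → opPow negTwo m (λ k → opPow negOne k f n) 0 ≡ sign m * opPow negTwo m f n
reflection zero    f n = sym (ℚₚ.*-identityˡ (f n))
reflection (suc m) f n = begin
  opPow negTwo m G 0 + negTwo * opPow negTwo m G 1
    ≡⟨ cong (λ z → opPow negTwo m G 0 + negTwo * z) (opPow-shift negTwo m G 0) ⟨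
  opPow negTwo m G 0 + negTwo * opPow negTwo m (λ k → G (suc k)) 0
    ≡⟨ cong (λ z → opPow negTwo m G 0 + negTwo * z) (opPow-cong negTwo m (λ k → opPow-inner negOne k f n) 0) ⟩
  opPow negTwo m G 0 + negTwo * opPow negTwo m (λ k → opPow negOne k Δf n) 0
    ≡⟨ cong₂ (λ a b → a + negTwo * b) (reflection m f n) (reflection m Δf n) ⟩
  sign m * x + negTwo * (sign m * opPow negTwo m Δf n)
    ≡⟨ cong (λ z → sign m * x + negTwo * (sign m * z)) (opPow-linear negTwo m f (λ k → f (suc k)) negOne n) ⟩
  sign m * x + negTwo * (sign m * (x + negOne * opPow negTwo m (λ k → f (suc k)) n))
    ≡⟨ cong (λ z → sign m * x + negTwo * (sign m * (x + negOne * z))) (opPow-shift negTwo m f n) ⟩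
  sign m * x + negTwo * (sign m * (x + negOne * y))
    ≡⟨ solve 3 (λ s a b → s :* a :+ (:- (con 1ℚ :+ con 1ℚ)) :* (s :* (a :+ (:- con 1ℚ) :* b))
                      := (:- s) :* (a :+ (:- (con 1ℚ :+ con 1ℚ)) :* b)) refl (sign m) x y ⟩
  sign (suc m) * opPow negTwo (suc m) f n ∎
  where
  G : ℕ → ℚ
  G k = opPow negOne k f n
  Δf : ℕ → ℚ
  Δf k = f k + negOne * f (suc k)
  x y : ℚ
  x = opPow negTwo m f n
  y = opPow negTwo m f (suc n)

transform-reflection : ∀ A m → opPow negTwo m (binTrans A) 0 ≡ sign m * opPow negTwo m A 0
transform-reflection A m = trans (opPow-cong negTwo m (binTrans-opPow A) 0) (reflection m A 0)

self-negating : ∀ x → x ≡ - x → x ≡ 0ℚ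
self-negating x x≡-x = begin
  x               ≡⟨ solve 1 (λ t → t := con ½ :* (t :+ t)) refl x ⟩
  ½ * (x + x)     ≡⟨ cong (λ z → ½ * (x + z)) x≡-x ⟩
  ½ * (x + - x)   ≡⟨ cong (½ *_) (ℚₚ.+-inverseʳ x) ⟩
  ½ * 0ℚ          ≡⟨ ℚₚ.*-zeroʳ ½ ⟩
  0ℚ              ∎

binomialSum-negTwoPow : ∀ m A → binomialSum negTwoPow m A ≡ opPow negTwo m A 0
binomialSum-negTwoPow = binomial-expansion negTwo negTwoPow refl (λ k → refl)

even-vanishes : ∀ A m → EvenSeq A → sign m ≡ - 1ℚ → binomialSum negTwoPow m A ≡ 0ℚ
even-vanishes A m even sign-m = trans (binomialSum-negTwoPow m A) (self-negating T (begin
  T                                     ≡⟨ opPow-cong negTwo m (λ k → sym (even k)) 0 ⟩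
  opPow negTwo m (binTrans A) 0         ≡⟨ transform-reflection A m ⟩
  sign m * T                            ≡⟨ cong (_* T) sign-m ⟩
  negOne * T                            ≡⟨ negOne-* T ⟩
  - T                                   ∎))
  where T = opPow negTwo m A 0

odd-vanishes : ∀ A m → OddSeq A → sign m ≡ 1ℚ → binomialSum negTwoPow m A ≡ 0ℚ
odd-vanishes A m odd sign-m = trans (binomialSum-negTwoPow m A) (self-negating T (begin
  T                                          ≡⟨ opPow-cong negTwo m A≡-binTrans 0 ⟩
  opPow negTwo m (λ k → negOne * binTrans A k) 0 ≡⟨ opPow-scale negTwo m negOne (binTrans A) 0 ⟩
  negOne * opPow negTwo m (binTrans A) 0     ≡⟨ cong (negOne *_) (transform-reflection A m) ⟩
  negOne * (sign m * T)                      ≡⟨ cong (λ s → negOne * (s * T)) sign-m ⟩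
  negOne * (1ℚ * T)                          ≡⟨ cong (negOne *_) (ℚₚ.*-identityˡ T) ⟩
  negOne * T                                 ≡⟨ negOne-* T ⟩
  - T                                        ∎))
  where
  T = opPow negTwo m A 0
  A≡-binTrans : ∀ k → A k ≡ negOne * binTrans A k
  A≡-binTrans k = begin
    A k              ≡⟨ solve 1 (λ a → a := :- (:- a)) refl (A k) ⟩
    - (- A k)        ≡⟨ cong -_ (odd k) ⟨
    - binTrans A k   ≡⟨ negOne-* (binTrans A k) ⟨
    negOne * binTrans A k ∎

correction : (a e v : ℕ → ℚ) → ℕ → ℚ
correction a e v zero    = 0ℚ
correction a e v (suc k) = (a k * correction a e v k + e k * v k) * inverseSuc k

congruent-recurrences : ∀ P (a e u v : ℕ → ℚ) → u 0 ≡ v 0 →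
  (∀ k → u (suc k) * ι (suc k) ≡ a k * u k) →
  (∀ k → v (suc k) * ι (suc k) ≡ (a k - P * e k) * v k) →
  ∀ k → u k ≡ v k + P * correction a e v k
congruent-recurrences P a e u v u₀ u-step v-step zero = begin
  u 0              ≡⟨ u₀ ⟩
  v 0              ≡⟨ solve 2 (λ v P → v := v :+ P :* con 0ℚ) refl (v 0) P ⟩
  v 0 + P * 0ℚ     ∎
congruent-recurrences P a e u v u₀ u-step v-step (suc k) = begin
  u (suc k)
    ≡⟨ divide-by-suc k (u-step k) ⟩
  (a k * u k) * r
    ≡⟨ cong (λ x → (a k * x) * r) (congruent-recurrences P a e u v u₀ u-step v-step k) ⟩
  (a k * (v k + P * z)) * r
    ≡⟨ solve 6 (λ a e v P z r → (a :* (v :+ P :* z)) :* r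
                                := ((a :- P :* e) :* v) :* r :+ P :* ((a :* z :+ e :* v) :* r))
               refl (a k) (e k) (v k) P z r ⟩
  ((a k - P * e k) * v k) * r + P * ((a k * z + e k * v k) * r)
    ≡⟨ cong (_+ P * correction a e v (suc k)) (divide-by-suc {v (suc k)} k (v-step k)) ⟨
  v (suc k) + P * correction a e v (suc k) ∎
  where
  r = inverseSuc k
  z = correction a e v k

-- The correction is a p-integer at every k < p, since it only divides by 1, ..., k.
pint-correction : ∀ {p} → Prime p → ∀ (a e v : ℕ → ℚ) →
  (∀ k → PInt p (a k)) → (∀ k → PInt p (e k)) → (∀ k → PInt p (v k)) →
  ∀ k → k < p → PInt p (correction a e v k)
pint-correction p-prime a e v pa pe pv zero    _   = pint-integer p-prime (+ 0)
pint-correction p-prime a e v pa pe pv (suc k) k+1<p =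
  pint-* p-prime (pint-+ p-prime (pint-* p-prime (pa k) (pint-correction p-prime a e v pa pe pv k k<p))
                                 (pint-* p-prime (pe k) (pv k)))
                 (pint-inverseSuc p-prime k k+1<p)
  where
  k<p = ℕₚ.<-trans (ℕₚ.n<1+n k) k+1<p

cb-recurrence : ∀ k → cb (suc k) * ι (suc k) ≡ ι (suc (k ℕ.+ k)) * cb k
cb-recurrence k = trans (scaled-fractions-≡ c′ (suc k) c (suc (k ℕ.+ k)) (2 ℕ.^ suc k) (2 ℕ.^ k)
                                            {{ℕₚ.m^n≢0 2 (suc k)}} {{ℕₚ.m^n≢0 2 k}} cross)
                        (ℚₚ.*-comm (cb k) _)
  where
  c′ = (2 ℕ.* suc k) C suc k
  c  = (2 ℕ.* k) C k
  rearrange : ∀ s c q → 2 ℕ.* (s ℕ.* c) ℕ.* q ≡ c ℕ.* s ℕ.* (2 ℕ.* q)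
  rearrange = solve-∀
  cross : c′ ℕ.* suc k ℕ.* 2 ℕ.^ k ≡ c ℕ.* suc (k ℕ.+ k) ℕ.* 2 ℕ.^ suc k
  cross = trans (cong (ℕ._* 2 ℕ.^ k) (central-binomial k)) (rearrange (suc (k ℕ.+ k)) c (2 ℕ.^ k))

absorption-ℚ : ∀ m k → ι (m C suc k) * ι (suc k) ≡ (ι m - ι k) * ι (m C k)
absorption-ℚ m k = begin
  X                                 ≡⟨ solve 2 (λ X K → X := (X :+ K) :- K) refl X K ⟩
  (X + K) - K                       ≡⟨ cong (_- K) sum ⟩
  ι m * ι (m C k) - K               ≡⟨ solve 3 (λ M K C → M :* C :- K :* C := (M :- K) :* C)
                                               refl (ι m) (ι k) (ι (m C k)) ⟩
  (ι m - ι k) * ι (m C k)           ∎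
  where
  X = ι (m C suc k) * ι (suc k)
  K = ι k * ι (m C k)
  sum : X + K ≡ ι m * ι (m C k)
  sum = begin
    X + K                                              ≡⟨ cong₂ _+_ (ι-* (m C suc k) (suc k)) (ι-* k (m C k)) ⟨
    ι ((m C suc k) ℕ.* suc k) + ι (k ℕ.* (m C k))      ≡⟨ ι-+ ((m C suc k) ℕ.* suc k) (k ℕ.* (m C k)) ⟨
    ι ((m C suc k) ℕ.* suc k ℕ.+ k ℕ.* (m C k))        ≡⟨ cong ι (absorption m k) ⟩
    ι (m ℕ.* (m C k))                                  ≡⟨ ι-* m (m C k) ⟩
    ι m * ι (m C k)                                    ∎

binomialWeight : ℕ → ℕ → ℚ
binomialWeight m k = ι (m C k) * negTwoPow k

binomialWeight-recurrence : ∀ m k →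
  binomialWeight m (suc k) * ι (suc k) ≡ (ι (suc (k ℕ.+ k)) - ι (suc (m ℕ.+ m)) * 1ℚ) * binomialWeight m k
binomialWeight-recurrence m k = begin
  (ι (m C suc k) * (negTwo * w)) * ι (suc k)
    ≡⟨ solve 4 (λ b n w s → (b :* (n :* w)) :* s := (b :* s) :* (n :* w)) refl (ι (m C suc k)) negTwo w (ι (suc k)) ⟩
  (ι (m C suc k) * ι (suc k)) * (negTwo * w)
    ≡⟨ cong (_* (negTwo * w)) (absorption-ℚ m k) ⟩
  ((ι m - ι k) * ι (m C k)) * (negTwo * w)
    ≡⟨ solve 4 (λ M K b w → ((M :- K) :* b) :* ((:- (con 1ℚ :+ con 1ℚ)) :* w)
                            := ((con 1ℚ :+ (K :+ K)) :- (con 1ℚ :+ (M :+ M)) :* con 1ℚ) :* (b :* w))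
               refl (ι m) (ι k) (ι (m C k)) w ⟩
  ((1ℚ + (ι k + ι k)) - (1ℚ + (ι m + ι m)) * 1ℚ) * binomialWeight m k
    ≡⟨ cong₂ (λ x y → (x - y * 1ℚ) * binomialWeight m k) (ι-odd k) (ι-odd m) ⟨
  (ι (suc (k ℕ.+ k)) - ι (suc (m ℕ.+ m)) * 1ℚ) * binomialWeight m k ∎
  where w = negTwoPow k

coefficientCorrection : ℕ → ℕ → ℚ
coefficientCorrection m = correction (λ k → ι (suc (k ℕ.+ k))) (λ _ → 1ℚ) (binomialWeight m)

coefficient-congruence : ∀ p m → p ≡ suc (m ℕ.+ m) →
                         ∀ k → cb k ≡ binomialWeight m k + ι p * coefficientCorrection m k
coefficient-congruence _ m refl = congruent-recurrences (ι (suc (m ℕ.+ m))) _ _ cb (binomialWeight m)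
                                    refl cb-recurrence (binomialWeight-recurrence m)

pint-coefficientCorrection : ∀ {p} → Prime p → ∀ m k → k < p → PInt p (coefficientCorrection m k)
pint-coefficientCorrection p-prime m = pint-correction p-prime _ _ _
  (λ k → pint-ι p-prime (suc (k ℕ.+ k))) (λ _ → pint-integer p-prime (+ 1))
  (λ k → pint-* p-prime (pint-ι p-prime (m C k)) (pint-negTwoPow p-prime k))

sum-congruence : ∀ {p} m → Prime p → p ≡ suc (m ℕ.+ m) →
                 (A : ℕ → ℚ) → (∀ k → k ≤ m → IsPInt p (A k)) →
                 binomialSum negTwoPow m A ≡ 0ℚ → CongMod p (sumTo m (λ k → cb k * A k)) 0ℚ
sum-congruence {p} m p-prime p≡2m+1 A pA T≡0 = Z , isPInt pint-Z , (begin
  sumTo m (λ k → cb k * A k) - 0ℚ                                       ≡⟨ ℚₚ.+-identityʳ _ ⟩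
  sumTo m (λ k → cb k * A k)                                            ≡⟨ sumTo-cong m split ⟩
  sumTo m (λ k → ι (m C k) * (negTwoPow k * A k) + ι p * (z k * A k))   ≡⟨ sumTo-+ m _ _ ⟩
  binomialSum negTwoPow m A + sumTo m (λ k → ι p * (z k * A k))         ≡⟨ cong₂ _+_ T≡0 (sumTo-scale m (ι p) _) ⟩
  0ℚ + ι p * Z                                                          ≡⟨ ℚₚ.+-identityˡ _ ⟩
  ι p * Z                                                               ∎)
  where
  z : ℕ → ℚ
  z = coefficientCorrection m
  Z : ℚ
  Z = sumTo m (λ k → z k * A k)
  split : ∀ k → cb k * A k ≡ ι (m C k) * (negTwoPow k * A k) + ι p * (z k * A k)
  split k = trans (cong (_* A k) (coefficient-congruence p m p≡2m+1 k))
                  (solve 5 (λ b w P z a → (b :* w :+ P :* z) :* a := b :* (w :* a) :+ P :* (z :* a))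
                         refl (ι (m C k)) (negTwoPow k) (ι p) (z k) (A k))
  k<p : ∀ {k} → k ≤ m → k < p
  k<p k≤m = subst (_ <_) (sym p≡2m+1) (s≤s (ℕₚ.≤-trans k≤m (ℕₚ.m≤m+n m m)))
  pint-Z : PInt p Z
  pint-Z = pint-sum p-prime m _ λ k k≤m →
    pint-* p-prime (pint-coefficientCorrection p-prime m k (k<p k≤m)) (pint (pA k k≤m))

halfOf : ℕ → ℕ
halfOf p = (p ∸ 1) / 2

odd-decomposition : ∀ {p} j → p ≡ suc (j ℕ.+ j) → p ≡ suc (halfOf p ℕ.+ halfOf p) × halfOf p ≡ j
odd-decomposition {p} j p≡2j+1 = subst (λ i → p ≡ suc (i ℕ.+ i)) (sym half≡j) p≡2j+1 , half≡j
  where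
  double : ∀ j → j ℕ.+ j ≡ j ℕ.* 2
  double = solve-∀
  half≡j : halfOf p ≡ j
  half≡j = trans (cong (λ q → (q ∸ 1) / 2) p≡2j+1) (trans (cong (_/ 2) (double j)) (m*n/n≡m j 2))

sign-even : ∀ q → sign (q ℕ.* 2) ≡ 1ℚ
sign-even zero    = refl
sign-even (suc q) = trans (solve 1 (λ x → :- (:- x) := x) refl (sign (q ℕ.* 2))) (sign-even q)

mod4≡3 : ∀ p → p % 4 ≡ 3 → p ≡ suc (halfOf p ℕ.+ halfOf p) × sign (halfOf p) ≡ - 1ℚ
mod4≡3 p p%4≡3 =
  let (p≡2m+1 , m≡j) = odd-decomposition (suc (q ℕ.* 2)) p≡2j+1
  in p≡2m+1 , trans (cong sign m≡j) (cong -_ (sign-even q))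
  where
  q = p / 4
  arith : ∀ q → 3 ℕ.+ q ℕ.* 4 ≡ suc (suc (q ℕ.* 2) ℕ.+ suc (q ℕ.* 2))
  arith = solve-∀
  p≡2j+1 : p ≡ suc (suc (q ℕ.* 2) ℕ.+ suc (q ℕ.* 2))
  p≡2j+1 = trans (m≡m%n+[m/n]*n p 4) (trans (cong (ℕ._+ q ℕ.* 4) p%4≡3) (arith q))

mod4≡1 : ∀ p → p % 4 ≡ 1 → p ≡ suc (halfOf p ℕ.+ halfOf p) × sign (halfOf p) ≡ 1ℚ
mod4≡1 p p%4≡1 =
  let (p≡2m+1 , m≡j) = odd-decomposition (q ℕ.* 2) p≡2j+1
  in p≡2m+1 , trans (cong sign m≡j) (sign-even q)
  where
  q = p / 4
  arith : ∀ q → 1 ℕ.+ q ℕ.* 4 ≡ suc (q ℕ.* 2 ℕ.+ q ℕ.* 2)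
  arith = solve-∀
  p≡2j+1 : p ≡ suc (q ℕ.* 2 ℕ.+ q ℕ.* 2)
  p≡2j+1 = trans (m≡m%n+[m/n]*n p 4) (trans (cong (ℕ._+ q ℕ.* 4) p%4≡1) (arith q))

-- The hypothesis p ≢ 2 is already implied by either residue condition.
theorem4p4 : (p : ℕ) → Prime p → p ≢ 2 → (A : ℕ → ℚ) →
  (∀ k → k ≤ (p ∸ 1) / 2 → IsPInt p (A k)) →
  ((EvenSeq A × p % 4 ≡ 3) ⊎ (OddSeq A × p % 4 ≡ 1)) →
  CongMod p (sumTo ((p ∸ 1) / 2) (λ k → cb k * A k)) 0ℚ
theorem4p4 p p-prime _ A pA (inj₁ (even , p%4≡3)) =
  let (p≡2m+1 , sign-m) = mod4≡3 p p%4≡3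
  in sum-congruence (halfOf p) p-prime p≡2m+1 A pA (even-vanishes A (halfOf p) even sign-m)
theorem4p4 p p-prime _ A pA (inj₂ (odd , p%4≡1)) =
  let (p≡2m+1 , sign-m) = mod4≡1 p p%4≡1
  in sum-congruence (halfOf p) p-prime p≡2m+1 A pA (odd-vanishes A (halfOf p) odd sign-m)
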